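{- Let $G=(V,E)$ be a finite simple graph on $n$ vertices and $\mathbb{F}$ a field. If there exists a proper coloring $c:V\to\{1,\dots,m\}$ of $G$ with locality $\ell$ such that $|\mathbb{F}|\ge m$, then $\mathrm{minrk}_{\mathbb{F}}(\overline{G})\le\ell$. In particular, if $|\mathbb{F}|\ge n$, then $\mathrm{minrk}_{\mathbb{F}}(\overline{G})\le\chi_l(G)$.
   Context: The locality of a proper coloring is the maximum, over all vertices $v$, of the number of distinct colors on the closed neighborhood $\{v\}\cup N(v)$, where $N(v)$ is the set of neighbors of $v$; the local chromatic number $\chi_l(G)$ is the smallest locality of a proper coloring of $G$. $\overline{G}$ is the complement of $G$. For a graph $G'$ on vertex set $\{1,\dots,n\}$, a matrix $M\in\mathbb{F}^{n\times n}$ represents $G'$ if $M_{i,i}\ne0$ for all $i$ and $M_{i,j}=0$ for all distinct non-adjacent $i,j$; $\mathrm{minrk}_{\mathbb{F}}(G')$ is the minimum rank over $\mathbb{F}$ of a matrix representing $G'$. -}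

module Defs where

open import Level using (Level; _⊔_) renaming (suc to lsuc; zero to lzero)
open import Data.Nat using (ℕ; zero; suc) renaming (_⊔_ to _⊔ℕ_)
open import Data.Fin using (Fin; zero; suc)
open import Data.Fin.Properties using (_≟_; any?)
open import Data.Fin.Subset using (Subset; ∣_∣)
open import Data.Vec using (tabulate)
open import Data.List using (List; foldr)
open import Data.Fin.Base using () 
open import Data.List using (allFin) renaming (map to mapL)
open import Data.Product using (Σ; ∃; _×_; _,_)
open import Data.Sum using (_⊎_)
open import Relation.Nullary using (¬_; Dec; does)
open import Relation.Nullary.Decidable using (_×-dec_; _⊎-dec_)
open import Relation.Binary using (Rel; Decidable)
open import Relation.Binary.PropositionalEquality using (_≡_; _≢_)
open import Algebra.Bundles using (CommutativeRing)

record Field (c ℓ : Level) : Set (lsuc (c ⊔ ℓ)) where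
  field
    commutativeRing : CommutativeRing c ℓ
  open CommutativeRing commutativeRing public
  field
    0≉1     : ¬ (0# ≈ 1#)
    inverse : ∀ x → ¬ (x ≈ 0#) → ∃ λ y → (x * y) ≈ 1#

record SimpleGraph (n : ℕ) : Set₁ where
  field
    Adj     : Rel (Fin n) lzero
    adj?    : Decidable Adj
    sym     : ∀ {u v} → Adj u v → Adj v u
    irrefl  : ∀ {v} → ¬ Adj v v

complement : ∀ {n} → SimpleGraph n → SimpleGraph n
complement {n} G = record
  { Adj    = λ u v → u ≢ v × ¬ Adj u v
  ; adj?   = λ u v → dec≢ u v ×-dec dec¬ u v
  ; sym    = λ { (u≢v , ¬a) → (λ e → u≢v (Eq.sym e)) , (λ a → ¬a (G-sym a)) }
  ; irrefl = λ { (v≢v , _) → v≢v Eq.refl }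
  }
  where
  open SimpleGraph G
  G-sym = SimpleGraph.sym G
  import Relation.Binary.PropositionalEquality as Eq
  open import Relation.Nullary.Decidable using (¬?)
  dec≢ : (u v : Fin n) → Dec (u ≢ v)
  dec≢ u v = ¬? (u ≟ v)
  dec¬ : (u v : Fin n) → Dec (¬ Adj u v)
  dec¬ u v = ¬? (adj? u v)

module _ {n : ℕ} (G : SimpleGraph n) where
  open SimpleGraph G

  IsProperColoring : ∀ {m} → (Fin n → Fin m) → Set
  IsProperColoring c = ∀ u v → Adj u v → c u ≢ c v

  InClosedNbhd : Fin n → Fin n → Set
  InClosedNbhd v u = u ≡ v ⊎ Adj v u

  colorsAt : ∀ {m} → (Fin n → Fin m) → Fin n → Subset m
  colorsAt c v = tabulate λ k →
    does (any? (λ u → ((u ≟ v) ⊎-dec (adj? v u)) ×-dec (c u ≟ k)))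

  localColors : ∀ {m} → (Fin n → Fin m) → Fin n → ℕ
  localColors c v = ∣ colorsAt c v ∣

  -- Locality of c: maximum over all vertices (0 if there are no vertices).
  locality : ∀ {m} → (Fin n → Fin m) → ℕ
  locality c = foldr _⊔ℕ_ 0 (mapL (localColors c) (allFin n))

  IsLocalChromaticNumber : ℕ → Set
  IsLocalChromaticNumber k =
    (∃ λ m → Σ (Fin n → Fin m) λ c → IsProperColoring c × locality c ≡ k)
    × (∀ m (c : Fin n → Fin m) → IsProperColoring c → k Data.Nat.≤ locality c)

module _ {c ℓ : Level} (F : Field c ℓ) where
  open Field F using (Carrier; _≈_; _+_; _*_; 0#)

  Matrix : ℕ → ℕ → Set c
  Matrix r s = Fin r → Fin s → Carrier

  sumF : ∀ r → (Fin r → Carrier) → Carrier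
  sumF zero    f = 0#
  sumF (suc r) f = f zero + sumF r (λ k → f (suc k))

  -- rank M ≤ r  (rank as the least inner dimension of a factorisation
  -- M = A B with A : n × r and B : r × n)
  RankAtMost : ∀ {n} → Matrix n n → ℕ → Set (c ⊔ ℓ)
  RankAtMost {n} M r = ∃ λ (A : Matrix n r) → ∃ λ (B : Matrix r n) →
    ∀ i j → M i j ≈ sumF r (λ k → A i k * B k j)

  Represents : ∀ {n} → SimpleGraph n → Matrix n n → Set ℓ
  Represents {n} G' M =
    (∀ i → ¬ (M i i ≈ 0#)) ×
    (∀ i j → i ≢ j → ¬ SimpleGraph.Adj G' i j → M i j ≈ 0#)

  MinrkAtMost : ∀ {n} → SimpleGraph n → ℕ → Set (c ⊔ ℓ)
  MinrkAtMost {n} G' r = ∃ λ (M : Matrix n n) → Represents G' M × RankAtMost M r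

  CardAtLeast : ℕ → Set (c ⊔ ℓ)
  CardAtLeast m = ∃ λ (α : Fin m → Carrier) → ∀ i j → α i ≈ α j → i ≡ j

{-# OPTIONS --safe #-}
module Submission where

-- Embed the colors into F by α, let S(v) be the set of colors on the closed neighbourhood
-- of v, and P_v := ∏_{s ∈ S(v) ∖ {c(v)}} (x − α s). The matrix M u v := P_u(α (c v))
-- represents the complement of G: α (c v) is not a root of P_v, while for u ~ v properness
-- puts c v in S(u) ∖ {c(u)}. Each P_u has |S(u)| ≤ ℓ coefficients, so M factors through
-- F^ℓ as (coefficients) · (Vandermonde). Only the colors actually used need distinct
-- α-values, and a coloring of n vertices uses at most n of them; this gives the bound
-- by χ_l(G) when |F| ≥ n.

open import Defs
open import Level using (Level)
open import Data.Nat using (ℕ)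
open import Data.Fin using (Fin)
open import Data.Product using (_×_)
open import Relation.Binary.PropositionalEquality using (_≡_)

open import Algebra.Bundles using (CommutativeRing)
open import Data.Empty using (⊥-elim)
import Data.Fin as Fin
open import Data.Fin.Properties using (_≟_; any?)
open import Data.Fin.Subset using (Subset; inside; outside; _∈_; _∉_; _─_; _-_; ∣_∣)
open import Data.Fin.Subset.Properties using (x∉⁅y⁆⇒x≢y; p─q⊆p; x∈p∧x≢y⇒x∈p-y; x∈p⇒∣p-x∣<∣p∣)
open import Data.List using (List; []; _∷_; length; foldr)
open import Data.List.Membership.Propositional using () renaming (_∈_ to _∈ₗ_)
open import Data.List.Membership.Propositional.Properties using (∈-map⁺; ∈-allFin)
import Data.List.Relation.Unary.Any as Any
open import Data.Nat as ℕ using (zero; suc; _≤_; _⊔_; s≤s)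
import Data.Nat.Properties as ℕ
open import Data.Maybe using (nothing)
open import Data.Product using (∃; _,_)
open import Data.Sum using (inj₁; inj₂)
open import Data.Vec using (_∷_; []; here; there)
open import Data.Vec.Properties using (lookup∘tabulate; lookup⇒[]=; []=⇒lookup)
open import Function using (_∘_)
open import Relation.Binary.PropositionalEquality as ≡ using (_≢_)
open import Relation.Nullary using (¬_; Dec; yes; no)
open import Relation.Nullary.Decidable using (dec-true; _×-dec_; _⊎-dec_)
open import Relation.Nullary.Reflects using (Reflects; invert)

x∈xs⇒x≤foldr-⊔ : ∀ {x} {xs : List ℕ} → x ∈ₗ xs → x ≤ foldr _⊔_ 0 xs
x∈xs⇒x≤foldr-⊔              (Any.here ≡.refl) = ℕ.m≤m⊔n _ _
x∈xs⇒x≤foldr-⊔ {xs = y ∷ _} (Any.there x∈xs) = ℕ.m≤n⇒m≤o⊔n y (x∈xs⇒x≤foldr-⊔ x∈xs)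

x∈p─q⇒x∉q : ∀ {n} {x : Fin n} (p q : Subset n) → x ∈ p ─ q → x ∉ q
x∈p─q⇒x∉q (_ ∷ p) (outside ∷ q) here          ()
x∈p─q⇒x∉q (_ ∷ p) (_       ∷ q) (there x∈p─q) (there x∈q) = x∈p─q⇒x∉q p q x∈p─q x∈q

module CoefficientPolynomial {c ℓ : Level} (R : CommutativeRing c ℓ) where
  open CommutativeRing R
  open import Algebra.Properties.Semiring.Exp semiring using (_^_)
  open import Algebra.Properties.Semiring.Sum semiring
    using (sum-syntax; sum-cong-≋; sum-replicate-zero; *-distribˡ-sum)
  open import Algebra.Properties.CommutativeSemigroup *-commutativeSemigroup using (x∙yz≈y∙xz)
  open import Relation.Binary.Reasoning.Setoid setoid
  open import Tactic.RingSolver.Core.AlmostCommutativeRing using (fromCommutativeRing)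
  open import Tactic.RingSolver.NonReflective (fromCommutativeRing R (λ _ → nothing)) using (solve; _⊜_)
  open import Tactic.RingSolver.Core.Expression using (_⊕_; _⊗_)

  -- Polynomials are coefficient lists, constant term first.
  eval : List Carrier → Carrier → Carrier
  eval []      x = 0#
  eval (a ∷ p) x = a + x * eval p x

  coefficient : List Carrier → ℕ → Carrier
  coefficient []      k       = 0#
  coefficient (a ∷ p) zero    = a
  coefficient (a ∷ p) (suc k) = coefficient p k

  infixl 6 _+[x+_]*_

  _+[x+_]*_ : Carrier → Carrier → List Carrier → List Carrier
  a +[x+ r ]* []      = a ∷ []
  a +[x+ r ]* (b ∷ p) = (a + r * b) ∷ (b +[x+ r ]* p)

  eval-+[x+]* : ∀ a r p x → eval (a +[x+ r ]* p) x ≈ a + (x + r) * eval p x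
  eval-+[x+]* a r []      x = +-congˡ (trans (zeroʳ x) (sym (zeroʳ (x + r))))
  eval-+[x+]* a r (b ∷ p) x = begin
    (a + r * b) + x * eval (b +[x+ r ]* p) x    ≈⟨ +-congˡ (*-congˡ (eval-+[x+]* b r p x)) ⟩
    (a + r * b) + x * (b + (x + r) * eval p x) ≈⟨ solve 5 (λ a r b x e →
                                                    ((a ⊕ (r ⊗ b)) ⊕ (x ⊗ (b ⊕ ((x ⊕ r) ⊗ e))))
                                                    ⊜ (a ⊕ ((x ⊕ r) ⊗ (b ⊕ (x ⊗ e)))))
                                                  refl a r b x (eval p x) ⟩
    a + (x + r) * (b + x * eval p x)           ∎

  length-+[x+]* : ∀ a r p → length (a +[x+ r ]* p) ≡ suc (length p)
  length-+[x+]* a r []      = ≡.refl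
  length-+[x+]* a r (b ∷ p) = ≡.cong suc (length-+[x+]* b r p)

  infixr 7 [x+_]*_

  [x+_]*_ : Carrier → List Carrier → List Carrier
  [x+ r ]* p = 0# +[x+ r ]* p

  eval-[x+]* : ∀ r p x → eval ([x+ r ]* p) x ≈ (x + r) * eval p x
  eval-[x+]* r p x = trans (eval-+[x+]* 0# r p x) (+-identityˡ _)

  vanishingPolynomial : ∀ {k} → Subset k → (Fin k → Carrier) → List Carrier
  vanishingPolynomial []            α = 1# ∷ []
  vanishingPolynomial (inside ∷ p)  α = [x+ - α Fin.zero ]* vanishingPolynomial p (α ∘ Fin.suc)
  vanishingPolynomial (outside ∷ p) α = vanishingPolynomial p (α ∘ Fin.suc)

  length-vanishingPolynomial : ∀ {k} (p : Subset k) α → length (vanishingPolynomial p α) ≡ suc ∣ p ∣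
  length-vanishingPolynomial []            α = ≡.refl
  length-vanishingPolynomial (inside ∷ p)  α =
    ≡.trans (length-+[x+]* 0# (- α Fin.zero) q) (≡.cong suc (length-vanishingPolynomial p (α ∘ Fin.suc)))
    where q = vanishingPolynomial p (α ∘ Fin.suc)
  length-vanishingPolynomial (outside ∷ p) α = length-vanishingPolynomial p _

  eval-vanishingPolynomial-root : ∀ {k} (p : Subset k) α {s} → s ∈ p →
                                  eval (vanishingPolynomial p α) (α s) ≈ 0#
  eval-vanishingPolynomial-root (inside ∷ p) α here = begin
    eval ([x+ - α₀ ]* q) α₀   ≈⟨ eval-[x+]* (- α₀) q α₀ ⟩
    (α₀ + - α₀) * eval q α₀   ≈⟨ *-congʳ (-‿inverseʳ α₀) ⟩
    0# * eval q α₀            ≈⟨ zeroˡ _ ⟩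
    0#                        ∎
    where α₀ = α Fin.zero
          q  = vanishingPolynomial p (α ∘ Fin.suc)
  eval-vanishingPolynomial-root (inside ∷ p) α {Fin.suc s} (there s∈p) = begin
    eval ([x+ - α Fin.zero ]* q) y   ≈⟨ eval-[x+]* _ q y ⟩
    (y + - α Fin.zero) * eval q y    ≈⟨ *-congˡ (eval-vanishingPolynomial-root p (α ∘ Fin.suc) s∈p) ⟩
    (y + - α Fin.zero) * 0#          ≈⟨ zeroʳ _ ⟩
    0#                               ∎
    where y = α (Fin.suc s)
          q = vanishingPolynomial p (α ∘ Fin.suc)
  eval-vanishingPolynomial-root (outside ∷ p) α (there s∈p) =
    eval-vanishingPolynomial-root p (α ∘ Fin.suc) s∈p

  eval≈∑coefficient : ∀ p L x → length p ≤ L →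
                      eval p x ≈ ∑[ k < L ] (coefficient p (Fin.toℕ k) * x ^ Fin.toℕ k)
  eval≈∑coefficient []      L       x _          = sym (begin
    ∑[ k < L ] (0# * x ^ Fin.toℕ k)  ≈⟨ sum-cong-≋ {L} (λ k → zeroˡ (x ^ Fin.toℕ k)) ⟩
    ∑[ k < L ] 0#                    ≈⟨ sum-replicate-zero L ⟩
    0#                               ∎)
  eval≈∑coefficient (a ∷ p) (suc L) x (s≤s p≤L) = begin
    a + x * eval p x
      ≈⟨ +-congˡ (*-congˡ (eval≈∑coefficient p L x p≤L)) ⟩
    a + x * ∑[ k < L ] (coefficient p (Fin.toℕ k) * x ^ Fin.toℕ k)
      ≈⟨ +-congˡ (*-distribˡ-sum {L} x _) ⟩
    a + ∑[ k < L ] (x * (coefficient p (Fin.toℕ k) * x ^ Fin.toℕ k))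
      ≈⟨ +-cong (sym (*-identityʳ a)) (sum-cong-≋ {L} (λ k → x∙yz≈y∙xz x _ _)) ⟩
    a * 1# + ∑[ k < L ] (coefficient p (Fin.toℕ k) * (x * x ^ Fin.toℕ k))
      ∎

module _ {c ℓ : Level} (F : Field c ℓ) where
  open Field F
  open CoefficientPolynomial commutativeRing
  open import Algebra.Properties.Group +-group using (x∙y⁻¹≈ε⇒x≈y)
  open import Algebra.Properties.Semiring.Exp semiring using (_^_)
  open import Algebra.Properties.Semiring.Sum semiring using (sum)
  open import Relation.Binary.Reasoning.Setoid setoid

  x≉0∧y≉0⇒x*y≉0 : ∀ {x y} → x ≉ 0# → y ≉ 0# → x * y ≉ 0#
  x≉0∧y≉0⇒x*y≉0 {x} {y} x≉0 y≉0 xy≈0 with inverse x x≉0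
  ... | x⁻¹ , xx⁻¹≈1 = y≉0 (begin
    y               ≈⟨ *-identityˡ y ⟨
    1# * y          ≈⟨ *-congʳ (trans (*-comm x⁻¹ x) xx⁻¹≈1) ⟨
    (x⁻¹ * x) * y   ≈⟨ *-assoc x⁻¹ x y ⟩
    x⁻¹ * (x * y)   ≈⟨ *-congˡ xy≈0 ⟩
    x⁻¹ * 0#        ≈⟨ zeroʳ x⁻¹ ⟩
    0#              ∎)

  eval-vanishingPolynomial-nonroot : ∀ {k} (p : Subset k) α {x} → (∀ {s} → s ∈ p → x ≉ α s) →
                                     eval (vanishingPolynomial p α) x ≉ 0#
  eval-vanishingPolynomial-nonroot []            α {x} _ 1+x*0≈0 = 0≉1 (begin
    0#           ≈⟨ 1+x*0≈0 ⟨
    1# + x * 0#  ≈⟨ +-congˡ (zeroʳ x) ⟩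
    1# + 0#      ≈⟨ +-identityʳ 1# ⟩
    1#           ∎)
  eval-vanishingPolynomial-nonroot (inside ∷ p)  α {x} x∉α[p] eval≈0 =
    x≉0∧y≉0⇒x*y≉0 (λ x-α₀≈0 → x∉α[p] here (x∙y⁻¹≈ε⇒x≈y x _ x-α₀≈0))
                  (eval-vanishingPolynomial-nonroot p (α ∘ Fin.suc) (x∉α[p] ∘ there))
                  (trans (sym (eval-[x+]* (- α Fin.zero) q x)) eval≈0)
    where q = vanishingPolynomial p (α ∘ Fin.suc)
  eval-vanishingPolynomial-nonroot (outside ∷ p) α x∉α[p] =
    eval-vanishingPolynomial-nonroot p (α ∘ Fin.suc) (x∉α[p] ∘ there)

  sumF≡sum : ∀ r (f : Fin r → Carrier) → sumF F r f ≡ sum f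
  sumF≡sum zero    f = ≡.refl
  sumF≡sum (suc r) f = ≡.cong (f Fin.zero +_) (sumF≡sum r (f ∘ Fin.suc))

  evaluationMatrix-rank : ∀ {n L} (P : Fin n → List Carrier) (x : Fin n → Carrier) →
                          (∀ i → length (P i) ≤ L) → RankAtMost F (λ i j → eval (P i) (x j)) L
  evaluationMatrix-rank {L = L} P x |P|≤L =
    (λ i k → coefficient (P i) (Fin.toℕ k)) , (λ k j → x j ^ Fin.toℕ k) ,
    λ i j → trans (eval≈∑coefficient (P i) L (x j) (|P|≤L i)) (reflexive (≡.sym (sumF≡sum L _)))

module _ {n : ℕ} (G : SimpleGraph n) {m : ℕ} (col : Fin n → Fin m) where
  open SimpleGraph G using (adj?)

  private
    closedNbhdHasColor? : ∀ v s → Dec (∃ λ u → InClosedNbhd G v u × col u ≡ s)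
    closedNbhdHasColor? v s = any? (λ u → ((u ≟ v) ⊎-dec (adj? v u)) ×-dec (col u ≟ s))

  colorsAt⁺ : ∀ {v u} → InClosedNbhd G v u → col u ∈ colorsAt G col v
  colorsAt⁺ {v} {u} u∈N[v] = lookup⇒[]= (col u) (colorsAt G col v)
    (≡.trans (lookup∘tabulate _ (col u)) (dec-true (closedNbhdHasColor? v (col u)) (u , u∈N[v] , ≡.refl)))

  colorsAt⁻ : ∀ {v s} → s ∈ colorsAt G col v → ∃ λ u → InClosedNbhd G v u × col u ≡ s
  colorsAt⁻ {v} {s} s∈colors = invert (≡.subst (Reflects _)
    (≡.trans (≡.sym (lookup∘tabulate _ s)) ([]=⇒lookup s∈colors))
    (Dec.proof (closedNbhdHasColor? v s)))

  localColors≤locality : ∀ v → localColors G col v ≤ locality G col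
  localColors≤locality v = x∈xs⇒x≤foldr-⊔ (∈-map⁺ (localColors G col) (∈-allFin v))

module _ {c ℓ : Level} (F : Field c ℓ) {n : ℕ} (G : SimpleGraph n) {m : ℕ} (col : Fin n → Fin m) where
  open Field F using (Carrier; _≈_; _≉_; 0#; commutativeRing)
  open SimpleGraph G using (adj?)
  open CoefficientPolynomial commutativeRing
    using (eval; vanishingPolynomial; length-vanishingPolynomial; eval-vanishingPolynomial-root)

  SeparatesColors : (Fin m → Carrier) → Set ℓ
  SeparatesColors α = ∀ u v → α (col u) ≈ α (col v) → col u ≡ col v

  minrk-complement≤locality : IsProperColoring G col → (α : Fin m → Carrier) → SeparatesColors α →
                              MinrkAtMost F (complement G) (locality G col)
  minrk-complement≤locality proper α separates =
    M , (M-diagonal≉0 , M-nonadjacent≈0) , evaluationMatrix-rank F P (α ∘ col) |P|≤locality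
    where
    P : Fin n → List Carrier
    P v = vanishingPolynomial (colorsAt G col v - col v) α

    M : Matrix F n n
    M u v = eval (P u) (α (col v))

    |P|≤locality : ∀ v → length (P v) ≤ locality G col
    |P|≤locality v = begin
      length (P v)                      ≡⟨ length-vanishingPolynomial (colorsAt G col v - col v) α ⟩
      suc ∣ colorsAt G col v - col v ∣  ≤⟨ x∈p⇒∣p-x∣<∣p∣ (colorsAt⁺ G col (inj₁ ≡.refl)) ⟩
      localColors G col v               ≤⟨ localColors≤locality G col v ⟩
      locality G col                    ∎
      where open ℕ.≤-Reasoning

    M-diagonal≉0 : ∀ v → M v v ≉ 0#
    M-diagonal≉0 v = eval-vanishingPolynomial-nonroot F (colorsAt G col v - col v) α α[col-v]∉roots
      where
      α[col-v]∉roots : ∀ {s} → s ∈ colorsAt G col v - col v → α (col v) ≉ α s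
      α[col-v]∉roots {s} s∈ α-eq with colorsAt⁻ G col (p─q⊆p _ _ s∈)
      ... | u , _ , ≡.refl = x∉⁅y⁆⇒x≢y (x∈p─q⇒x∉q _ _ s∈) (≡.sym (separates v u α-eq))

    M-nonadjacent≈0 : ∀ u v → u ≢ v → ¬ SimpleGraph.Adj (complement G) u v → M u v ≈ 0#
    M-nonadjacent≈0 u v u≢v nonadjacent with adj? u v
    ... | no ¬adjacent = ⊥-elim (nonadjacent (u≢v , ¬adjacent))
    ... | yes adjacent = eval-vanishingPolynomial-root _ α
            (x∈p∧x≢y⇒x∈p-y (colorsAt⁺ G col (inj₂ adjacent)) (proper u v adjacent ∘ ≡.sym))

  separatingColors : CardAtLeast F n → ∃ SeparatesColors
  separatingColors (β , β-injective) = α , separates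
    where
    α : Fin m → Carrier
    α s with any? (λ u → col u ≟ s)
    ... | yes (u , _) = β u
    ... | no _        = 0#

    α∘col-via-β : ∀ u → ∃ λ w → col w ≡ col u × α (col u) ≡ β w
    α∘col-via-β u with any? (λ w → col w ≟ col u)
    ... | yes (w , col-w≡col-u) = w , col-w≡col-u , ≡.refl
    ... | no ∄w                 = ⊥-elim (∄w (u , ≡.refl))

    separates : SeparatesColors α
    separates u v α-eq with α∘col-via-β u | α∘col-via-β v
    ... | w₁ , c₁ , a₁ | w₂ , c₂ , a₂ =
      ≡.trans (≡.sym c₁) (≡.trans (≡.cong col (β-injective w₁ w₂ (≡.subst₂ _≈_ a₁ a₂ α-eq))) c₂)

proposition6p5 : ∀ {c ℓ' : Level} (F : Field c ℓ') (n : ℕ) (G : SimpleGraph n) →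
    (∀ (m ℓ : ℕ) (col : Fin n → Fin m) →
      IsProperColoring G col → locality G col ≡ ℓ → CardAtLeast F m →
      MinrkAtMost F (complement G) ℓ)
    × (∀ (k : ℕ) → IsLocalChromaticNumber G k → CardAtLeast F n →
      MinrkAtMost F (complement G) k)
proposition6p5 F n G =
  (λ { m ℓ col proper ≡.refl (α , α-injective) →
       minrk-complement≤locality F G col proper α (λ u v → α-injective (col u) (col v)) }) ,
  (λ { k ((m , col , proper , ≡.refl) , _) |F|≥n →
       let α , separates = separatingColors F G col |F|≥n
       in minrk-complement≤locality F G col proper α separates })
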